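{- Let $(F,\alpha)$ be a transformed special instance and let $C^*$ be the multiset of clauses of $F$ that are not of the form $(x)$ for a variable $x$. Let $H^*$ be the hypergraph with vertex set $V(F)$ and edge multiset $\{V(c): c\in C^*\}$. Then $\mathrm{sat}(F)\ge\alpha$ if and only if $H^*$ has a hitting set of size at most $|E(H^*)|-k$, where $k=\alpha-\nu(F)$.
   Context: A CNF formula $F$ is a finite multiset of clauses; each clause is a nonempty set of literals (a variable or its negation) not containing both a variable and its negation. $V(F)$ is the set of variables, $V(c)$ the set of variables of clause $c$. A truth assignment satisfies a clause if some literal of it is true; $\mathrm{sat}(F)$ is the maximum number of clauses (with multiplicity) satisfied by a truth assignment. $B_F$ is the bipartite graph on $V(F)\cup F$ with $v$ adjacent to $c$ iff $v\in V(c)$, and $\nu(F)$ is its maximum matching size. $n(x)$, $n(\bar x)$ are the numbers of clauses containing the literal $x$, $\bar x$. $(F,\alpha)$ (with $\alpha$ an integer) is a transformed special instance if every clause contains at most one positive literal, every variable $x$ has $n(x)=1$ and $n(\bar x)\ge 2$, and the unique clause containing $x$ is the unit clause $(x)$. A hypergraph has a vertex set and a multiset of nonempty vertex subsets as edges; a hitting set is a vertex set meeting every edge; $|E(H^*)|$ counts edges with multiplicity. -}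

module Defs where

open import Data.Nat using (ℕ; zero; suc; _≤_; _≥_; _⊔_; _≡ᵇ_)
open import Data.Bool using (Bool; true; false; _∧_; _∨_; not)
open import Data.Maybe using (Maybe; just; nothing; is-just)
open import Data.Fin using (Fin; zero; suc)
open import Data.Fin.Subset using (Subset; Nonempty; _∩_)
open import Data.List using (List; []; _∷_; length; filterᵇ; map; foldr; allFin; lookup; concatMap)
open import Data.List.Relation.Unary.All using (All)
open import Data.List.Membership.Propositional using (_∈_)
open import Data.Vec using (Vec; tabulate)
open import Data.Product using (Σ; ∃; _×_)
open import Relation.Binary.PropositionalEquality using (_≡_; _≢_)

-- Variables are Fin n.  A clause is a set of literals with no complementary
-- pair: for each variable x, c x = nothing (x ∉ V(c)), just true (literal x),
-- or just false (literal x̄).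
Clause : ℕ → Set
Clause n = Fin n → Maybe Bool

-- A CNF formula: a finite multiset of clauses (list, order irrelevant).
Formula : ℕ → Set
Formula n = List (Clause n)

countFin : ∀ {n} → (Fin n → Bool) → ℕ
countFin {n} p = length (filterᵇ p (allFin n))

present : ∀ {n} → Clause n → Fin n → Bool
present c x = is-just (c x)

positive : ∀ {n} → Clause n → Fin n → Bool
positive c x with c x
... | just true = true
... | _ = false

negative : ∀ {n} → Clause n → Fin n → Bool
negative c x with c x
... | just false = true
... | _ = false

NonemptyClause : ∀ {n} → Clause n → Set
NonemptyClause c = ∃ λ x → c x ≢ nothing

WellFormed : ∀ {n} → Formula n → Set
WellFormed F = All NonemptyClause F

nPos : ∀ {n} → Formula n → Fin n → ℕ
nPos F x = length (filterᵇ (λ c → positive c x) F)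

nNeg : ∀ {n} → Formula n → Fin n → ℕ
nNeg F x = length (filterᵇ (λ c → negative c x) F)

Assignment : ℕ → Set
Assignment n = Fin n → Bool

litTrue : Bool → Maybe Bool → Bool
litTrue b nothing = false
litTrue true (just true) = true
litTrue false (just false) = true
litTrue true (just false) = false
litTrue false (just true) = false

satisfiesClause : ∀ {n} → Assignment n → Clause n → Bool
satisfiesClause {n} a c = foldr _∨_ false (map (λ x → litTrue (a x) (c x)) (allFin n))

numSat : ∀ {n} → Assignment n → Formula n → ℕ
numSat a F = length (filterᵇ (satisfiesClause a) F)

extend : ∀ {n} → Bool → Assignment n → Assignment (suc n)
extend b a zero = b
extend b a (suc x) = a x

allAssignments : (n : ℕ) → List (Assignment n)
allAssignments zero = (λ ()) ∷ []
allAssignments (suc n) = concatMap (λ a → extend false a ∷ extend true a ∷ []) (allAssignments n)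

sat : ∀ {n} → Formula n → ℕ
sat {n} F = foldr _⊔_ 0 (map (λ a → numSat a F) (allAssignments n))

-- Matchings in B_F: each clause (index i) is matched to at most one variable
-- of that clause, and each variable to at most one clause.
IsMatching : ∀ {n} (F : Formula n) → (Fin (length F) → Maybe (Fin n)) → Set
IsMatching F M =
  (∀ i v → M i ≡ just v → lookup F i v ≢ nothing) ×
  (∀ i j v → M i ≡ just v → M j ≡ just v → i ≡ j)

matchingSize : ∀ {m n} → (Fin m → Maybe (Fin n)) → ℕ
matchingSize M = countFin (λ i → is-just (M i))

IsMaxMatchingSize : ∀ {n} → Formula n → ℕ → Set
IsMaxMatchingSize F ν =
  (∃ λ M → IsMatching F M × matchingSize M ≡ ν) ×
  (∀ M → IsMatching F M → matchingSize M ≤ ν)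

isPosUnit : ∀ {n} → Clause n → Bool
isPosUnit c = (countFin (present c) ≡ᵇ 1) ∧ (countFin (positive c) ≡ᵇ 1)

-- (F, α) transformed special instance (the conditions do not involve α)
TransformedSpecial : ∀ {n} → Formula n → Set
TransformedSpecial {n} F =
  (∀ c → c ∈ F → countFin (positive c) ≤ 1) ×
  (∀ (x : Fin n) → nPos F x ≡ 1 × nNeg F x ≥ 2) ×
  (∀ (x : Fin n) c → c ∈ F → c x ≡ just true → ∀ y → y ≢ x → c y ≡ nothing)

record Hypergraph (n : ℕ) : Set where
  field
    edges : List (Subset n)

open Hypergraph public

numEdges : ∀ {n} → Hypergraph n → ℕ
numEdges H = length (edges H)

IsHittingSet : ∀ {n} → Hypergraph n → Subset n → Set
IsHittingSet H S = All (λ e → Nonempty (e ∩ S)) (edges H)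

varSet : ∀ {n} → Clause n → Subset n
varSet c = tabulate (present c)

Cstar : ∀ {n} → Formula n → Formula n
Cstar F = filterᵇ (λ c → not (isPosUnit c)) F

Hstar : ∀ {n} → Formula n → Hypergraph n
Hstar F = record { edges = map varSet (Cstar F) }

-- In a transformed special instance every variable x occurs positively exactly once, namely in
-- the unit clause (x), so every clause of C* is purely negative.  An assignment therefore
-- satisfies exactly the units of its true variables and exactly those clauses of C* that its
-- set of false variables meets.  Hence a hitting set S of H* yields the assignment "false
-- exactly on S", which satisfies n − |S| + |C*| clauses; conversely, adding one variable of
-- every unsatisfied clause of C* to the false variables of an assignment satisfying s clauses
-- gives a hitting set of size at most n + |C*| − s.  So sat(F) + τ(H*) = n + |C*|.  Matching
-- every clause to its positive variable covers all n variables, so ν(F) = n, and the claimed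
-- equivalence is this identity rearranged over ℤ.
module Submission where

module Counting where

  open import Defs using (countFin; matchingSize)
  open import Data.Nat using (ℕ; zero; suc; _+_; _*_; _≤_; z≤n; s≤s)
  open import Data.Nat.Properties
    using (≤-reflexive; ≤-trans; +-mono-≤; +-monoʳ-≤; +-suc; +-identityʳ; *-identityʳ; *-zeroʳ;
           m≤m+n; m≤n+m; +-0-commutativeMonoid; module ≤-Reasoning)
  open import Data.Bool using (Bool; true; false; _∧_; not)
  open import Data.Bool.Properties using (∧-zeroʳ; ∧-identityʳ)
  open import Data.Maybe using (Maybe; just; nothing; is-just)
  open import Data.Maybe.Properties using (just-injective) renaming (≡-dec to ≡-decᵐ)
  open import Data.Fin as Fin using (Fin; zero; suc)
  open import Data.Fin.Properties using (suc-injective)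
  open import Data.Fin.Subset using (Subset; ∣_∣; _∈_; _∪_)
  open import Data.Fin.Subset.Properties using (∣p∣≤∣x∷p∣)
  open import Data.List as List using (List; []; _∷_; length; filterᵇ; lookup)
  open import Data.Vec as Vec using ([]; _∷_; tabulate)
  open import Data.Vec.Properties using ([]=⇒lookup; lookup⇒[]=; lookup∘tabulate; tabulate∘lookup)
  open import Function using (_∘_; id; _⇔_; mk⇔)
  open import Relation.Nullary using (Dec; yes; does; contradiction)
  open import Relation.Nullary.Decidable using (dec-true; dec-false)
  open import Relation.Binary.PropositionalEquality
  open import Algebra.Properties.CommutativeMonoid.Sum +-0-commutativeMonoid public
    using (sum-syntax; sum-cong-≗; ∑-comm)
  open import Algebra.Properties.CommutativeMonoid.Sum +-0-commutativeMonoid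
    using (sum-replicate-zero; ∑-distrib-+)

  private variable
    A : Set
    m n : ℕ

  𝟙 : Bool → ℕ
  𝟙 true = 1
  𝟙 false = 0

  𝟙-not+𝟙 : (b : Bool) → 𝟙 (not b) + 𝟙 b ≡ 1
  𝟙-not+𝟙 true = refl
  𝟙-not+𝟙 false = refl

  ∑-1 : ∀ n → ∑[ i < n ] 1 ≡ n
  ∑-1 zero = refl
  ∑-1 (suc n) = cong suc (∑-1 n)

  ∑-mono-≤ : {f g : Fin n → ℕ} → (∀ i → f i ≤ g i) → ∑[ i < n ] f i ≤ ∑[ i < n ] g i
  ∑-mono-≤ {zero} f≤g = z≤n
  ∑-mono-≤ {suc n} f≤g = +-mono-≤ (f≤g zero) (∑-mono-≤ (f≤g ∘ suc))

  ≤-∑ : (f : Fin n → ℕ) (i : Fin n) → f i ≤ ∑[ j < n ] f j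
  ≤-∑ f zero = m≤m+n (f zero) _
  ≤-∑ f (suc i) = ≤-trans (≤-∑ (f ∘ suc) i) (m≤n+m _ (f zero))

  ∑-𝟙-false : {p : Fin n → Bool} → (∀ i → p i ≡ false) → ∑[ i < n ] 𝟙 (p i) ≡ 0
  ∑-𝟙-false {n} p≡false = trans (sum-cong-≗ (cong 𝟙 ∘ p≡false)) (sum-replicate-zero n)

  ∑-𝟙-single : {p : Fin n → Bool} (i : Fin n) → (∀ j → j ≢ i → p j ≡ false) →
               ∑[ j < n ] 𝟙 (p j) ≡ 𝟙 (p i)
  ∑-𝟙-single {suc n} {p} zero p≡false =
    trans (cong (λ k → 𝟙 (p zero) + k) (∑-𝟙-false (λ j → p≡false (suc j) (λ ())))) (+-identityʳ _)
  ∑-𝟙-single {suc n} (suc i) p≡false rewrite p≡false zero (λ ()) =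
    ∑-𝟙-single i (λ j j≢i → p≡false (suc j) (j≢i ∘ suc-injective))

  ∑-𝟙-∧ʳ : (p : Fin n → Bool) (b : Bool) → ∑[ i < n ] 𝟙 (p i ∧ b) ≡ ∑[ i < n ] 𝟙 (p i) * 𝟙 b
  ∑-𝟙-∧ʳ {n} p true =
    trans (sum-cong-≗ (cong 𝟙 ∘ ∧-identityʳ ∘ p)) (sym (*-identityʳ (∑[ i < n ] 𝟙 (p i))))
  ∑-𝟙-∧ʳ {n} p false =
    trans (∑-𝟙-false (∧-zeroʳ ∘ p)) (sym (*-zeroʳ (∑[ i < n ] 𝟙 (p i))))

  ∑-𝟙≤1⇒unique : {p : Fin n → Bool} → ∑[ i < n ] 𝟙 (p i) ≤ 1 →
                 ∀ i j → p i ≡ true → p j ≡ true → i ≡ j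
  ∑-𝟙≤1⇒unique ∑≤1 zero zero _ _ = refl
  ∑-𝟙≤1⇒unique {suc n} {p} ∑≤1 zero (suc j) p0 pj = contradiction (≤-trans 2≤∑ ∑≤1) λ { (s≤s ()) }
    where
    2≤∑ : 2 ≤ ∑[ i < suc n ] 𝟙 (p i)
    2≤∑ = +-mono-≤ (≤-reflexive (cong 𝟙 (sym p0)))
                   (subst (_≤ ∑[ i < n ] 𝟙 (p (suc i))) (cong 𝟙 pj) (≤-∑ (𝟙 ∘ p ∘ suc) j))
  ∑-𝟙≤1⇒unique {p = p} ∑≤1 (suc i) zero pi p0 = sym (∑-𝟙≤1⇒unique {p = p} ∑≤1 zero (suc i) p0 pi)
  ∑-𝟙≤1⇒unique {p = p} ∑≤1 (suc i) (suc j) pi pj =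
    cong suc (∑-𝟙≤1⇒unique (≤-trans (m≤n+m _ (𝟙 (p zero))) ∑≤1) i j pi pj)

  unique⇒∑-𝟙≤1 : {p : Fin n → Bool} → (∀ i j → p i ≡ true → p j ≡ true → i ≡ j) →
                 ∑[ i < n ] 𝟙 (p i) ≤ 1
  unique⇒∑-𝟙≤1 {zero} unique = z≤n
  unique⇒∑-𝟙≤1 {suc n} {p} unique with p zero in p0
  ... | true = ≤-reflexive (cong suc (∑-𝟙-false p≡false))
    where
    p≡false : ∀ i → p (suc i) ≡ false
    p≡false i with p (suc i) in pi
    ... | true with () ← unique zero (suc i) p0 pi
    ... | false = refl
  ... | false = unique⇒∑-𝟙≤1 (λ i j pi pj → suc-injective (unique (suc i) (suc j) pi pj))

  length-filterᵇ-tabulate : (p : A → Bool) (f : Fin n → A) →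
                            length (filterᵇ p (List.tabulate f)) ≡ ∑[ i < n ] 𝟙 (p (f i))
  length-filterᵇ-tabulate {n = zero} p f = refl
  length-filterᵇ-tabulate {n = suc n} p f with p (f zero)
  ... | true = cong suc (length-filterᵇ-tabulate p (f ∘ suc))
  ... | false = length-filterᵇ-tabulate p (f ∘ suc)

  length-filterᵇ≡∑ : (p : A → Bool) (xs : List A) →
                     length (filterᵇ p xs) ≡ ∑[ i < length xs ] 𝟙 (p (lookup xs i))
  length-filterᵇ≡∑ p [] = refl
  length-filterᵇ≡∑ p (x ∷ xs) with p x
  ... | true = cong suc (length-filterᵇ≡∑ p xs)
  ... | false = length-filterᵇ≡∑ p xs

  length-filterᵇ-cong : {p q : A → Bool} → (∀ x → p x ≡ q x) → (xs : List A) →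
                        length (filterᵇ p xs) ≡ length (filterᵇ q xs)
  length-filterᵇ-cong {p = p} {q} p≗q xs = begin
    length (filterᵇ p xs)                   ≡⟨ length-filterᵇ≡∑ p xs ⟩
    ∑[ i < length xs ] 𝟙 (p (lookup xs i))  ≡⟨ sum-cong-≗ (cong 𝟙 ∘ p≗q ∘ lookup xs) ⟩
    ∑[ i < length xs ] 𝟙 (q (lookup xs i))  ≡⟨ length-filterᵇ≡∑ q xs ⟨
    length (filterᵇ q xs)                   ∎
    where open ≡-Reasoning

  length-filterᵇ-split : (q p : A → Bool) (xs : List A) →
    length (filterᵇ p xs) ≡
    length (filterᵇ (λ x → q x ∧ p x) xs) + length (filterᵇ p (filterᵇ (not ∘ q) xs))
  length-filterᵇ-split q p [] = refl
  length-filterᵇ-split q p (x ∷ xs) with q x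
  ... | true with p x
  ...   | true  = cong suc (length-filterᵇ-split q p xs)
  ...   | false = length-filterᵇ-split q p xs
  length-filterᵇ-split q p (x ∷ xs) | false with p x
  ...   | true  = trans (cong suc (length-filterᵇ-split q p xs)) (sym (+-suc _ _))
  ...   | false = length-filterᵇ-split q p xs

  length-filterᵇ+length-filterᵇ-not : (p : A → Bool) (xs : List A) →
    length (filterᵇ p xs) + length (filterᵇ (not ∘ p) xs) ≡ length xs
  length-filterᵇ+length-filterᵇ-not p [] = refl
  length-filterᵇ+length-filterᵇ-not p (x ∷ xs) with p x
  ... | true = cong suc (length-filterᵇ+length-filterᵇ-not p xs)
  ... | false = trans (+-suc _ _) (cong suc (length-filterᵇ+length-filterᵇ-not p xs))

  countFin≡∑ : (p : Fin n → Bool) → countFin p ≡ ∑[ i < n ] 𝟙 (p i)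
  countFin≡∑ p = length-filterᵇ-tabulate p id

  countFin-not+countFin : (p : Fin n → Bool) → countFin (not ∘ p) + countFin p ≡ n
  countFin-not+countFin {n} p = begin
    countFin (not ∘ p) + countFin p                 ≡⟨ cong₂ _+_ (countFin≡∑ (not ∘ p)) (countFin≡∑ p) ⟩
    ∑[ i < n ] 𝟙 (not (p i)) + ∑[ i < n ] 𝟙 (p i)  ≡⟨ ∑-distrib-+ (𝟙 ∘ not ∘ p) (𝟙 ∘ p) ⟨
    ∑[ i < n ] (𝟙 (not (p i)) + 𝟙 (p i))            ≡⟨ sum-cong-≗ (𝟙-not+𝟙 ∘ p) ⟩
    ∑[ i < n ] 1                                    ≡⟨ ∑-1 n ⟩
    n                                               ∎
    where open ≡-Reasoning

  ∣tabulate∣≡∑ : (p : Fin n → Bool) → ∣ tabulate p ∣ ≡ ∑[ i < n ] 𝟙 (p i)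
  ∣tabulate∣≡∑ {zero} p = refl
  ∣tabulate∣≡∑ {suc n} p with p zero
  ... | true = cong suc (∣tabulate∣≡∑ (p ∘ suc))
  ... | false = ∣tabulate∣≡∑ (p ∘ suc)

  countFin≡∣tabulate∣ : (p : Fin n → Bool) → countFin p ≡ ∣ tabulate p ∣
  countFin≡∣tabulate∣ p = trans (countFin≡∑ p) (sym (∣tabulate∣≡∑ p))

  countFin-lookup : (p : Subset n) → countFin (Vec.lookup p) ≡ ∣ p ∣
  countFin-lookup p = trans (countFin≡∣tabulate∣ (Vec.lookup p)) (cong ∣_∣ (tabulate∘lookup p))

  ∈-tabulate⇔ : {p : Fin n → Bool} {x : Fin n} → x ∈ tabulate p ⇔ p x ≡ true
  ∈-tabulate⇔ {p = p} {x} = mk⇔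
    (λ x∈p → trans (sym (lookup∘tabulate p x)) ([]=⇒lookup x∈p))
    (λ px → lookup⇒[]= x (tabulate p) (trans (lookup∘tabulate p x) px))

  ∣p∪q∣≤∣p∣+∣q∣ : (p q : Subset n) → ∣ p ∪ q ∣ ≤ ∣ p ∣ + ∣ q ∣
  ∣p∪q∣≤∣p∣+∣q∣ [] [] = z≤n
  ∣p∪q∣≤∣p∣+∣q∣ (true ∷ p) (b ∷ q) =
    s≤s (≤-trans (∣p∪q∣≤∣p∣+∣q∣ p q) (+-monoʳ-≤ (∣ p ∣) (∣p∣≤∣x∷p∣ b q)))
  ∣p∪q∣≤∣p∣+∣q∣ (false ∷ p) (true ∷ q) =
    ≤-trans (s≤s (∣p∪q∣≤∣p∣+∣q∣ p q)) (≤-reflexive (sym (+-suc (∣ p ∣) (∣ q ∣))))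
  ∣p∪q∣≤∣p∣+∣q∣ (false ∷ p) (false ∷ q) = ∣p∪q∣≤∣p∣+∣q∣ p q

  _≟ᵐ_ : (u v : Maybe (Fin n)) → Dec (u ≡ v)
  _≟ᵐ_ = ≡-decᵐ Fin._≟_

  𝟙-is-just : (u : Maybe (Fin n)) → 𝟙 (is-just u) ≡ ∑[ v < n ] 𝟙 (does (u ≟ᵐ just v))
  𝟙-is-just {n} nothing = sym (∑-𝟙-false {n} (λ v → dec-false (nothing ≟ᵐ just v) λ ()))
  𝟙-is-just (just w) = sym (trans
    (∑-𝟙-single w (λ v v≢w → dec-false (just w ≟ᵐ just v) (v≢w ∘ sym ∘ just-injective)))
    (cong 𝟙 (dec-true (just w ≟ᵐ just w) refl)))

  matchingSize≤ : (M : Fin m → Maybe (Fin n)) →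
                  (∀ i j v → M i ≡ just v → M j ≡ just v → i ≡ j) → matchingSize M ≤ n
  matchingSize≤ {m} {n} M injective = begin
    matchingSize M                                  ≡⟨ countFin≡∑ (is-just ∘ M) ⟩
    ∑[ i < m ] 𝟙 (is-just (M i))                    ≡⟨ sum-cong-≗ (𝟙-is-just ∘ M) ⟩
    ∑[ i < m ] ∑[ v < n ] 𝟙 (does (M i ≟ᵐ just v))  ≡⟨ ∑-comm (λ i v → 𝟙 (does (M i ≟ᵐ just v))) ⟩
    ∑[ v < n ] ∑[ i < m ] 𝟙 (does (M i ≟ᵐ just v))  ≤⟨ ∑-mono-≤ (λ v → unique⇒∑-𝟙≤1 (λ i j ei ej →
                                                         injective i j v (≟ᵐ-sound ei) (≟ᵐ-sound ej))) ⟩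
    ∑[ v < n ] 1                                    ≡⟨ ∑-1 n ⟩
    n                                               ∎
    where
    open ≤-Reasoning
    ≟ᵐ-sound : ∀ {u v} → does (u ≟ᵐ v) ≡ true → u ≡ v
    ≟ᵐ-sound {u} {v} _ with u ≟ᵐ v
    ... | yes u≡v = u≡v

module MaxSat where

  open import Defs
  open Counting
  open import Data.Nat using (ℕ; zero; suc; _+_; _*_; _≤_; _⊔_; z≤n)
  open import Data.Nat.Properties
    using (≤-reflexive; ≤-trans; ≤-antisym; +-mono-≤; +-monoʳ-≤; *-identityˡ; ⊔-sel; m≤m⊔n; m≤n⊔m;
           +-comm; +-commutativeSemigroup; module ≤-Reasoning)
  open import Data.Bool as Bool using (Bool; true; false; _∧_; _∨_; not; T; T?)
  open import Data.Bool.Properties using (∧-zeroʳ; ¬-not; T-≡; T-not-≡)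
  open import Data.Maybe using (Maybe; just; nothing; is-just)
  open import Data.Fin as Fin using (Fin; zero; suc)
  open import Data.Fin.Properties using (any?)
  open import Data.Fin.Subset using (Subset; ∣_∣; _∈_; _∩_; _∪_; ⁅_⁆; ⊥; Nonempty)
  open import Data.Fin.Subset.Properties using (∣⊥∣≡0; ∣⁅x⁆∣≡1; x∈⁅x⁆; x∈p∩q⁺; x∈p∩q⁻; x∈p∪q⁺)
  open import Data.List as List using (List; []; _∷_; length; filterᵇ; lookup; map; allFin)
  open import Data.List.Properties using (map-cong; filter-all; foldr-preservesᵒ)
  open import Data.List.Relation.Unary.All as All using (All; []; _∷_)
  open import Data.List.Relation.Unary.All.Properties using (map⁺; map⁻; filter⁺)
  open import Data.List.Relation.Unary.Any as Any using (Any; here; there)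
  open import Data.List.Relation.Unary.Any.Properties as Any using (any⁺; any⁻; concatMap⁺)
  open import Data.List.Membership.Propositional using (find; lose) renaming (_∈_ to _∈ₗ_)
  open import Data.List.Membership.Propositional.Properties
    using (∈-allFin; ∈-lookup; ∈-filter⁺; ∈-filter⁻; ∈-map⁻; foldr-selective)
  open import Data.Vec as Vec using (tabulate)
  open import Data.Vec.Properties using ([]=⇒lookup)
  open import Data.Product using (∃; _×_; _,_; proj₁; proj₂)
  open import Data.Sum using (_⊎_; inj₁; inj₂)
  open import Data.Empty using (⊥-elim)
  open import Function using (_∘_; _⇔_; mk⇔; Equivalence)
  open import Relation.Nullary using (Dec; yes; no; contradiction)
  open import Relation.Binary.PropositionalEquality
  open import Algebra.Properties.CommutativeSemigroup +-commutativeSemigroup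
    using (interchange; xy∙z≈xz∙y)

  open Equivalence using (to; from)

  private variable n : ℕ

  positive≡true⇒ : (c : Clause n) (x : Fin n) → positive c x ≡ true → c x ≡ just true
  positive≡true⇒ c x p with c x
  positive≡true⇒ c x refl | just true = refl

  just-true⇒positive : (c : Clause n) (x : Fin n) → c x ≡ just true → positive c x ≡ true
  just-true⇒positive c x cx rewrite cx = refl

  nothing⇒¬positive : (c : Clause n) (x : Fin n) → c x ≡ nothing → positive c x ≡ false
  nothing⇒¬positive c x cx rewrite cx = refl

  ≢nothing⇒present : (c : Clause n) (x : Fin n) → c x ≢ nothing → present c x ≡ true
  ≢nothing⇒present c x cx≢nothing with c x
  ... | just _ = refl
  ... | nothing = contradiction refl cx≢nothing

  IsUnitClause : Clause n → Fin n → Set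
  IsUnitClause c x = c x ≡ just true × (∀ y → y ≢ x → c y ≡ nothing)

  IsNegativeClause : Clause n → Set
  IsNegativeClause c = ∀ x → positive c x ≡ false

  positiveLiteral? : (c : Clause n) → Dec (∃ λ x → positive c x ≡ true)
  positiveLiteral? c = any? (λ x → positive c x Bool.≟ true)

  positiveVar : Clause n → Maybe (Fin n)
  positiveVar c with positiveLiteral? c
  ... | yes (x , _) = just x
  ... | no _ = nothing

  positiveVar-positive : {c : Clause n} {x : Fin n} → positiveVar c ≡ just x → positive c x ≡ true
  positiveVar-positive {c = c} _ with positiveLiteral? c
  positiveVar-positive refl | yes (x , px) = px

  isPosUnit-unit : {c : Clause n} {x : Fin n} → IsUnitClause c x → isPosUnit c ≡ true
  isPosUnit-unit {c = c} {x} (cx , others)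
    rewrite countFin≡∑ (present c) | countFin≡∑ (positive c)
          | ∑-𝟙-single {p = present c} x (λ y y≢x → cong is-just (others y y≢x))
          | ∑-𝟙-single {p = positive c} x (λ y y≢x → nothing⇒¬positive c y (others y y≢x))
          | cx = refl

  isPosUnit-negative : {c : Clause n} → IsNegativeClause c → isPosUnit c ≡ false
  isPosUnit-negative {c = c} negative rewrite countFin≡∑ (positive c) | ∑-𝟙-false negative =
    ∧-zeroʳ _

  satisfies⇔ : {a : Assignment n} {c : Clause n} →
               satisfiesClause a c ≡ true ⇔ ∃ λ x → litTrue (a x) (c x) ≡ true
  satisfies⇔ {n} {a} {c} = mk⇔
    (λ s → let x , _ , l = find (any⁻ literal (allFin n) (from T-≡ s)) in x , to T-≡ l)
    (λ (x , l) → to T-≡ (any⁺ literal (lose (∈-allFin x) (from T-≡ l))))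
    where
    literal : Fin n → Bool
    literal x = litTrue (a x) (c x)

  satisfies-unit : {a : Assignment n} {c : Clause n} {x : Fin n} →
                   IsUnitClause c x → satisfiesClause a c ≡ a x
  satisfies-unit {a = a} {c} {x} (cx , others) with a x in ax
  ... | true = from satisfies⇔ (x , subst (λ l → litTrue (a x) l ≡ true) (sym cx)
                                           (cong (λ b → litTrue b (just true)) ax))
  ... | false = ¬-not (λ s → let y , l = to satisfies⇔ s in falsified y l)
    where
    falsified : ∀ y → litTrue (a y) (c y) ≢ true
    falsified y with y Fin.≟ x
    ... | yes refl rewrite cx | ax = λ ()
    ... | no y≢x rewrite others y y≢x = λ ()

  litTrue-negative⇔ : {c : Clause n} {x : Fin n} (b : Bool) → positive c x ≡ false →
                      litTrue b (c x) ≡ true ⇔ (present c x ≡ true × b ≡ false)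
  litTrue-negative⇔ {c = c} {x} b ¬positive with c x
  litTrue-negative⇔ b () | just true
  litTrue-negative⇔ true ¬positive | just false = mk⇔ (λ ()) (λ ())
  litTrue-negative⇔ false ¬positive | just false = mk⇔ (λ _ → refl , refl) (λ _ → refl)
  litTrue-negative⇔ b ¬positive | nothing = mk⇔ (λ ()) (λ ())

  satisfies-negative⇔ : {a : Assignment n} {c : Clause n} → IsNegativeClause c →
                        satisfiesClause a c ≡ true ⇔ ∃ λ x → present c x ≡ true × a x ≡ false
  satisfies-negative⇔ {a = a} {c} negative = mk⇔
    (λ s → let x , l = to satisfies⇔ s in x , to (literal⇔ x) l)
    (λ (x , px , ax) → from satisfies⇔ (x , from (literal⇔ x) (px , ax)))
    where
    literal⇔ : ∀ x → litTrue (a x) (c x) ≡ true ⇔ (present c x ≡ true × a x ≡ false)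
    literal⇔ x = litTrue-negative⇔ {c = c} (a x) (negative x)

  hits⇔ : {c : Clause n} {S : Subset n} →
          Nonempty (varSet c ∩ S) ⇔ ∃ λ x → present c x ≡ true × x ∈ S
  hits⇔ {c = c} {S} = mk⇔
    (λ (x , x∈c∩S) → let x∈c , x∈S = x∈p∩q⁻ (varSet c) S x∈c∩S in x , to ∈-tabulate⇔ x∈c , x∈S)
    (λ (x , px , x∈S) → x , x∈p∩q⁺ (from ∈-tabulate⇔ px , x∈S))

  transversal : (L : Formula n) → All NonemptyClause L → Subset n
  transversal [] [] = ⊥
  transversal (c ∷ L) ((x , _) ∷ nonempty) = ⁅ x ⁆ ∪ transversal L nonempty

  ∣transversal∣≤length : (L : Formula n) (nonempty : All NonemptyClause L) →
                         ∣ transversal L nonempty ∣ ≤ length L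
  ∣transversal∣≤length {n} [] [] = ≤-reflexive (∣⊥∣≡0 n)
  ∣transversal∣≤length (c ∷ L) ((x , _) ∷ nonempty) =
    ≤-trans (∣p∪q∣≤∣p∣+∣q∣ ⁅ x ⁆ _)
            (+-mono-≤ (≤-reflexive (∣⁅x⁆∣≡1 x)) (∣transversal∣≤length L nonempty))

  transversal-hits : {c : Clause n} (L : Formula n) (nonempty : All NonemptyClause L) → c ∈ₗ L →
                     ∃ λ x → present c x ≡ true × x ∈ transversal L nonempty
  transversal-hits {c = c} (c ∷ L) ((x , cx≢nothing) ∷ _) (here refl) =
    x , ≢nothing⇒present c x cx≢nothing , x∈p∪q⁺ (inj₁ (x∈⁅x⁆ x))
  transversal-hits (_ ∷ L) (_ ∷ nonempty) (there c∈L) =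
    let x , px , x∈T = transversal-hits L nonempty c∈L in x , px , x∈p∪q⁺ (inj₂ x∈T)

  allAssignments-complete : (a : Assignment n) → Any (_≗ a) (allAssignments n)
  allAssignments-complete {zero} a = here (λ ())
  allAssignments-complete {suc n} a =
    concatMap⁺ _ (Any.map extend≗ (allAssignments-complete (a ∘ suc)))
    where
    extend≗ : ∀ {b} → b ≗ a ∘ suc → Any (_≗ a) (extend false b ∷ extend true b ∷ [])
    extend≗ b≗a with a zero in a0
    ... | false = here λ { zero → sym a0 ; (suc x) → b≗a x }
    ... | true = there (here λ { zero → sym a0 ; (suc x) → b≗a x })

  numSat-cong : {a b : Assignment n} → a ≗ b → (F : Formula n) → numSat a F ≡ numSat b F
  numSat-cong {n} a≗b = length-filterᵇ-cong λ c →
    cong (List.foldr _∨_ false) (map-cong (λ x → cong (λ v → litTrue v (c x)) (a≗b x)) (allFin n))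

  numSat≤sat : (F : Formula n) (a : Assignment n) → numSat a F ≤ sat F
  numSat≤sat {n} F a = foldr-preservesᵒ ≤⊔ 0 (map (λ b → numSat b F) (allAssignments n))
    (inj₂ (Any.map⁺ (Any.map (λ b≗a → ≤-reflexive (numSat-cong (sym ∘ b≗a) F))
                             (allAssignments-complete a))))
    where
    ≤⊔ : ∀ x y → numSat a F ≤ x ⊎ numSat a F ≤ y → numSat a F ≤ x ⊔ y
    ≤⊔ x y (inj₁ ≤x) = ≤-trans ≤x (m≤m⊔n x y)
    ≤⊔ x y (inj₂ ≤y) = ≤-trans ≤y (m≤n⊔m x y)

  sat-attained : (F : Formula n) → ∃ λ a → sat F ≤ numSat a F
  sat-attained {n} F with foldr-selective ⊔-sel 0 (map (λ b → numSat b F) (allAssignments n))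
  ... | inj₁ sat≡0 = (λ _ → true) , subst (_≤ numSat (λ _ → true) F) (sym sat≡0) z≤n
  ... | inj₂ sat∈ = let a , _ , sat≡ = ∈-map⁻ (λ b → numSat b F) sat∈ in a , ≤-reflexive sat≡

  module _ {n : ℕ} {F : Formula n} (special : TransformedSpecial F) where

    private
      nPos≡1 : ∀ x → nPos F x ≡ 1
      nPos≡1 x = proj₁ (proj₁ (proj₂ special) x)

      positive⇒unit : ∀ x c → c ∈ₗ F → c x ≡ just true → ∀ y → y ≢ x → c y ≡ nothing
      positive⇒unit = proj₂ (proj₂ special)

      ∑-positive≡1 : ∀ x → ∑[ i < length F ] 𝟙 (positive (lookup F i) x) ≡ 1
      ∑-positive≡1 x = trans (sym (length-filterᵇ≡∑ (λ c → positive c x) F)) (nPos≡1 x)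

    unit-or-negative : {c : Clause n} → c ∈ₗ F → (∃ λ x → IsUnitClause c x) ⊎ IsNegativeClause c
    unit-or-negative {c} c∈F with positiveLiteral? c
    ... | yes (x , px) = inj₁ (x , cx , positive⇒unit x c c∈F cx)
      where
      cx : c x ≡ just true
      cx = positive≡true⇒ c x px
    ... | no ¬px = inj₂ (λ x → ¬-not (λ px → ¬px (x , px)))

    Cstar-negative : {c : Clause n} → c ∈ₗ Cstar F → IsNegativeClause c
    Cstar-negative c∈C* with ∈-filter⁻ (T? ∘ not ∘ isPosUnit) c∈C*
    ... | c∈F , ¬unit with unit-or-negative c∈F
    ... | inj₁ (_ , unit) = ⊥-elim (subst (T ∘ not) (isPosUnit-unit unit) ¬unit)
    ... | inj₂ negative = negative

    𝟙-satisfied-unit : (a : Assignment n) {c : Clause n} → c ∈ₗ F →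
                       𝟙 (isPosUnit c ∧ satisfiesClause a c) ≡ ∑[ x < n ] 𝟙 (positive c x ∧ a x)
    𝟙-satisfied-unit a {c} c∈F with unit-or-negative c∈F
    ... | inj₁ (x , unit@(cx , others))
      rewrite isPosUnit-unit unit | satisfies-unit {a = a} unit
            | ∑-𝟙-single {p = λ y → positive c y ∧ a y} x
                (λ y y≢x → cong (_∧ a y) (nothing⇒¬positive c y (others y y≢x)))
            | just-true⇒positive c x cx = refl
    ... | inj₂ negative rewrite isPosUnit-negative negative =
      sym (∑-𝟙-false (λ x → cong (_∧ a x) (negative x)))

    numSat-units : (a : Assignment n) →
                   length (filterᵇ (λ c → isPosUnit c ∧ satisfiesClause a c) F) ≡ countFin a
    numSat-units a = begin
      length (filterᵇ (λ c → isPosUnit c ∧ satisfiesClause a c) F)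
        ≡⟨ length-filterᵇ≡∑ _ F ⟩
      ∑[ i < length F ] 𝟙 (isPosUnit (lookup F i) ∧ satisfiesClause a (lookup F i))
        ≡⟨ sum-cong-≗ (λ i → 𝟙-satisfied-unit a (∈-lookup i)) ⟩
      ∑[ i < length F ] ∑[ x < n ] 𝟙 (positive (lookup F i) x ∧ a x)
        ≡⟨ ∑-comm (λ i x → 𝟙 (positive (lookup F i) x ∧ a x)) ⟩
      ∑[ x < n ] ∑[ i < length F ] 𝟙 (positive (lookup F i) x ∧ a x)
        ≡⟨ sum-cong-≗ (λ x → ∑-𝟙-∧ʳ (λ i → positive (lookup F i) x) (a x)) ⟩
      ∑[ x < n ] (∑[ i < length F ] 𝟙 (positive (lookup F i) x) * 𝟙 (a x))
        ≡⟨ sum-cong-≗ (λ x → trans (cong (_* 𝟙 (a x)) (∑-positive≡1 x)) (*-identityˡ (𝟙 (a x)))) ⟩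
      ∑[ x < n ] 𝟙 (a x)
        ≡⟨ countFin≡∑ a ⟨
      countFin a
        ∎
      where open ≡-Reasoning

    numSat≡countFin+numSat-Cstar : (a : Assignment n) → numSat a F ≡ countFin a + numSat a (Cstar F)
    numSat≡countFin+numSat-Cstar a = trans (length-filterᵇ-split isPosUnit (satisfiesClause a) F)
                                           (cong (_+ numSat a (Cstar F)) (numSat-units a))

    𝟙-positiveVar : {c : Clause n} → c ∈ₗ F → 𝟙 (is-just (positiveVar c)) ≡ ∑[ x < n ] 𝟙 (positive c x)
    𝟙-positiveVar {c} c∈F with positiveLiteral? c | unit-or-negative c∈F
    ... | yes _ | inj₁ (x , cx , others) = sym (trans
      (∑-𝟙-single x (λ y y≢x → nothing⇒¬positive c y (others y y≢x)))
      (cong 𝟙 (just-true⇒positive c x cx)))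
    ... | yes (x , px) | inj₂ negative = contradiction (trans (sym px) (negative x)) λ ()
    ... | no ¬px | inj₁ (x , cx , _) = contradiction (x , just-true⇒positive c x cx) ¬px
    ... | no _ | inj₂ negative = sym (∑-𝟙-false negative)

    unitMatching : Fin (length F) → Maybe (Fin n)
    unitMatching i = positiveVar (lookup F i)

    unitMatching-isMatching : IsMatching F unitMatching
    unitMatching-isMatching = inClause , injective
      where
      inClause : ∀ i v → unitMatching i ≡ just v → lookup F i v ≢ nothing
      inClause i v e cv≡nothing = contradiction
        (trans (sym (positiveVar-positive e)) (nothing⇒¬positive (lookup F i) v cv≡nothing)) λ ()
      injective : ∀ i j v → unitMatching i ≡ just v → unitMatching j ≡ just v → i ≡ j
      injective i j v ei ej = ∑-𝟙≤1⇒unique (≤-reflexive (∑-positive≡1 v)) i j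
                                (positiveVar-positive ei) (positiveVar-positive ej)

    matchingSize-unitMatching : matchingSize unitMatching ≡ n
    matchingSize-unitMatching = begin
      matchingSize unitMatching
        ≡⟨ countFin≡∑ (is-just ∘ unitMatching) ⟩
      ∑[ i < length F ] 𝟙 (is-just (unitMatching i))
        ≡⟨ sum-cong-≗ (λ i → 𝟙-positiveVar (∈-lookup i)) ⟩
      ∑[ i < length F ] ∑[ x < n ] 𝟙 (positive (lookup F i) x)
        ≡⟨ ∑-comm (λ i x → 𝟙 (positive (lookup F i) x)) ⟩
      ∑[ x < n ] ∑[ i < length F ] 𝟙 (positive (lookup F i) x)
        ≡⟨ sum-cong-≗ ∑-positive≡1 ⟩
      ∑[ x < n ] 1
        ≡⟨ ∑-1 n ⟩
      n
        ∎
      where open ≡-Reasoning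

    maxMatchingSize≡n : ∀ {ν} → IsMaxMatchingSize F ν → ν ≡ n
    maxMatchingSize≡n {ν} ((M , isMatching , size≡ν) , maximum) = ≤-antisym
      (subst (_≤ n) size≡ν (matchingSize≤ M (proj₂ isMatching)))
      (subst (_≤ ν) matchingSize-unitMatching (maximum unitMatching unitMatching-isMatching))

    hittingSet⇒assignment : {S : Subset n} → IsHittingSet (Hstar F) S →
                            ∃ λ a → numSat a F + ∣ S ∣ ≡ length (Cstar F) + n
    hittingSet⇒assignment {S} hitting = not ∘ Vec.lookup S , (begin
      numSat a F + ∣ S ∣                     ≡⟨ cong (_+ ∣ S ∣) (numSat≡countFin+numSat-Cstar a) ⟩
      countFin a + numSat a (Cstar F) + ∣ S ∣  ≡⟨ cong (λ k → countFin a + k + ∣ S ∣) all-satisfied ⟩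
      countFin a + length (Cstar F) + ∣ S ∣    ≡⟨ xy∙z≈xz∙y (countFin a) (length (Cstar F)) (∣ S ∣) ⟩
      countFin a + ∣ S ∣ + length (Cstar F)    ≡⟨ cong (_+ length (Cstar F)) countFin+∣S∣≡n ⟩
      n + length (Cstar F)                   ≡⟨ +-comm n (length (Cstar F)) ⟩
      length (Cstar F) + n                   ∎)
      where
      open ≡-Reasoning
      a : Assignment n
      a = not ∘ Vec.lookup S

      countFin+∣S∣≡n : countFin a + ∣ S ∣ ≡ n
      countFin+∣S∣≡n =
        trans (cong (countFin a +_) (sym (countFin-lookup S))) (countFin-not+countFin (Vec.lookup S))

      satisfied : ∀ {c} → c ∈ₗ Cstar F → T (satisfiesClause a c)
      satisfied c∈C* =
        let x , px , x∈S = to hits⇔ (All.lookup (map⁻ hitting) c∈C*)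
        in from T-≡ (from (satisfies-negative⇔ (Cstar-negative c∈C*))
                          (x , px , cong not ([]=⇒lookup x∈S)))

      all-satisfied : numSat a (Cstar F) ≡ length (Cstar F)
      all-satisfied = cong length (filter-all (T? ∘ satisfiesClause a) (All.tabulate satisfied))

    assignment⇒hittingSet : WellFormed F → (a : Assignment n) →
      ∃ λ S → IsHittingSet (Hstar F) S × numSat a F + ∣ S ∣ ≤ length (Cstar F) + n
    assignment⇒hittingSet wellFormed a = S , map⁺ (All.tabulate hit) , size
      where
      falseVars : Subset n
      falseVars = tabulate (not ∘ a)
      unsatisfied : Formula n
      unsatisfied = filterᵇ (not ∘ satisfiesClause a) (Cstar F)
      repairs : Subset n
      repairs = transversal unsatisfied (filter⁺ _ (filter⁺ _ wellFormed))
      S : Subset n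
      S = falseVars ∪ repairs

      hit : ∀ {c} → c ∈ₗ Cstar F → Nonempty (varSet c ∩ S)
      hit {c} c∈C* with satisfiesClause a c in satisfied
      ... | true =
        let x , px , ax = to (satisfies-negative⇔ (Cstar-negative c∈C*)) satisfied
        in from hits⇔ (x , px , x∈p∪q⁺ (inj₁ (from ∈-tabulate⇔ (cong not ax))))
      ... | false =
        let c∈unsatisfied = ∈-filter⁺ (T? ∘ not ∘ satisfiesClause a) c∈C* (from T-not-≡ satisfied)
            x , px , x∈repairs = transversal-hits unsatisfied _ c∈unsatisfied
        in from hits⇔ (x , px , x∈p∪q⁺ (inj₂ x∈repairs))

      size : numSat a F + ∣ S ∣ ≤ length (Cstar F) + n
      size = begin
        numSat a F + ∣ S ∣
          ≤⟨ +-monoʳ-≤ (numSat a F) (≤-trans (∣p∪q∣≤∣p∣+∣q∣ falseVars repairs)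
                                             (+-monoʳ-≤ (∣ falseVars ∣) (∣transversal∣≤length unsatisfied _))) ⟩
        numSat a F + (∣ falseVars ∣ + length unsatisfied)
          ≡⟨ cong₂ (λ k l → k + (l + length unsatisfied))
                   (numSat≡countFin+numSat-Cstar a) (sym (countFin≡∣tabulate∣ (not ∘ a))) ⟩
        (countFin a + numSat a (Cstar F)) + (countFin (not ∘ a) + length unsatisfied)
          ≡⟨ interchange (countFin a) (numSat a (Cstar F)) (countFin (not ∘ a)) (length unsatisfied) ⟩
        (countFin a + countFin (not ∘ a)) + (numSat a (Cstar F) + length unsatisfied)
          ≡⟨ cong₂ _+_ (trans (+-comm (countFin a) _) (countFin-not+countFin a))
                       (length-filterᵇ+length-filterᵇ-not (satisfiesClause a) (Cstar F)) ⟩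
        n + length (Cstar F)
          ≡⟨ +-comm n (length (Cstar F)) ⟩
        length (Cstar F) + n
          ∎
        where open ≤-Reasoning


open import Defs
open import Data.Nat using (ℕ)
open import Data.Integer using (ℤ; 0ℤ; +_; _+_; _-_; _≤_; +≤+)
open import Data.Integer.Properties using (≤-trans; i≤j⇒0≤j-i; 0≤i-j⇒j≤i; +-monoˡ-≤)
open import Data.Integer.Solver using (module +-*-Solver)
open import Data.Fin.Subset using (Subset; ∣_∣)
open import Data.List using (length)
open import Data.List.Properties using (length-map)
open import Data.Product using (∃; _×_; _,_)
open import Function using (_⇔_; mk⇔; Equivalence)
open import Relation.Binary.PropositionalEquality using (_≡_; refl; sym; cong; subst)
open +-*-Solver
open Equivalence using (to; from)
open MaxSat

≤-respects-difference : {i j k l : ℤ} → j - i ≡ l - k → i ≤ j → k ≤ l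
≤-respects-difference j-i≡l-k i≤j = 0≤i-j⇒j≤i (subst (0ℤ ≤_) j-i≡l-k (i≤j⇒0≤j-i i≤j))

+-cancelʳ-≤ : (i j k : ℤ) → i + k ≤ j + k → i ≤ j
+-cancelʳ-≤ i j k =
  ≤-respects-difference (solve 3 (λ i j k → (j :+ k) :- (i :+ k) := j :- i) refl i j k)

i≤j-[k-l]⇔k+i≤j+l : (i j k l : ℤ) → i ≤ j - (k - l) ⇔ k + i ≤ j + l
i≤j-[k-l]⇔k+i≤j+l i j k l = mk⇔ (≤-respects-difference eq) (≤-respects-difference (sym eq))
  where
  eq : j - (k - l) - i ≡ j + l - (k + i)
  eq = solve 4 (λ i j k l → j :- (k :- l) :- i := j :+ l :- (k :+ i)) refl i j k l

lemma12 : ∀ {n : ℕ} (F : Formula n) (α : ℤ) → WellFormed F → TransformedSpecial F →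
    (ν : ℕ) → IsMaxMatchingSize F ν →
    (α ≤ + sat F) ⇔
    (∃ λ (S : Subset n) → IsHittingSet (Hstar F) S × + ∣ S ∣ ≤ + numEdges (Hstar F) - (α - + ν))
lemma12 {n} F α wellFormed special ν maxMatching
  rewrite maxMatchingSize≡n special maxMatching | length-map varSet (Cstar F) =
  mk⇔ hittingSet satisfying
  where
  m : ℕ
  m = length (Cstar F)

  hittingSet : α ≤ + sat F → ∃ λ S → IsHittingSet (Hstar F) S × + ∣ S ∣ ≤ + m - (α - + n)
  hittingSet α≤sat =
    let a , sat≤numSat = sat-attained F
        S , hitting , size = assignment⇒hittingSet special wellFormed a
    in S , hitting , from (i≤j-[k-l]⇔k+i≤j+l (+ ∣ S ∣) (+ m) α (+ n))
                       (≤-trans (+-monoˡ-≤ (+ ∣ S ∣) (≤-trans α≤sat (+≤+ sat≤numSat))) (+≤+ size))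

  satisfying : (∃ λ S → IsHittingSet (Hstar F) S × + ∣ S ∣ ≤ + m - (α - + n)) → α ≤ + sat F
  satisfying (S , hitting , bound) with hittingSet⇒assignment special hitting
  ... | a , numSat+∣S∣≡m+n =
    ≤-trans (+-cancelʳ-≤ α (+ numSat a F) (+ ∣ S ∣) α+∣S∣≤) (+≤+ (numSat≤sat F a))
    where
    α+∣S∣≤ : α + + ∣ S ∣ ≤ + numSat a F + + ∣ S ∣
    α+∣S∣≤ = subst (α + + ∣ S ∣ ≤_) (cong +_ (sym numSat+∣S∣≡m+n))
                   (to (i≤j-[k-l]⇔k+i≤j+l (+ ∣ S ∣) (+ m) α (+ n)) bound)
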